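{- Let $A$ be a set and $f\colon A\rightarrow\wp A$ a function. Define, by transfinite recursion on ordinals $\gamma$, the sets $$B_\gamma=\Big\{x\in A\ \Big|\ f(x)\subseteq\bigcup_{i\in\gamma}B_i\Big\},$$ and let $\mathcal{B}=\bigcup_{\gamma\in\mathrm{Ord}}B_\gamma\subseteq A$, where $\mathrm{Ord}$ is the class of all ordinals. Then $\mathcal{B}$ is not in the range of $f$, i.e. there is no $a\in A$ with $f(a)=\mathcal{B}$.
   Context: $\wp A$ denotes the powerset of $A$; ordinals are von Neumann ordinals, so $i\in\gamma$ means $i<\gamma$. -}

module Defs where

open import Data.Product using (Σ; Σ-syntax; _×_)

℘ : Set → Set₁
℘ A = A → Set

_⊆_ : {A : Set} → ℘ A → ℘ A → Set
P ⊆ Q = ∀ x → P x → Q x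

-- Ordinals, type-theoretically: Brouwer-style well-founded trees
-- (sup I g has the members g i, i : I, as its elements i ∈ γ).
-- The class Ord of all ordinals becomes the large type Ord : Set₁.
data Ord : Set₁ where
  sup : (I : Set) → (I → Ord) → Ord

B : {A : Set} → (A → ℘ A) → Ord → A → Set
B f (sup I g) x = ∀ y → f x y → Σ[ i ∈ I ] B f (g i) y

𝓑 : {A : Set} → (A → ℘ A) → A → Set₁
𝓑 f x = Σ[ γ ∈ Ord ] B f γ x

_≐_ : {A : Set} → ℘ A → (A → Set₁) → Set₁
P ≐ Q = ∀ x → (P x → Q x) × (Q x → P x)

{-# OPTIONS --safe #-}
module Submission where

-- 𝓑 contains every x with f x ⊆ 𝓑 (bound the stages of the elements of f x
-- by one ordinal), and no x ∈ 𝓑 lies in f x (by well-founded recursion on its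
-- stage). So if f a = 𝓑, then a ∈ 𝓑 and hence a ∈ f a, which is impossible.

open import Defs
open import Data.Product using (Σ; Σ-syntax; _,_; proj₁; proj₂)
open import Relation.Nullary using (¬_)

B⇒¬self-image : {A : Set} (f : A → ℘ A) (γ : Ord) {x : A} → B f γ x → ¬ f x x
B⇒¬self-image f (sup I g) x∈B x∈fx with x∈B _ x∈fx
... | i , x∈Bgi = B⇒¬self-image f (g i) x∈Bgi x∈fx

𝓑-closed : {A : Set} (f : A → ℘ A) {x : A} → (∀ y → f x y → 𝓑 f y) → 𝓑 f x
𝓑-closed f {x} fx⊆𝓑 = sup (Σ[ y ∈ _ ] f x y) stage , fx⊆⋃stage
  where
  stage : Σ[ y ∈ _ ] f x y → Ord
  stage (y , y∈fx) = proj₁ (fx⊆𝓑 y y∈fx)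

  fx⊆⋃stage : B f (sup (Σ[ y ∈ _ ] f x y) stage) x
  fx⊆⋃stage y y∈fx = (y , y∈fx) , proj₂ (fx⊆𝓑 y y∈fx)

mainTheorem3 : (A : Set) (f : A → ℘ A) → ¬ (Σ[ a ∈ A ] (f a ≐ 𝓑 f))
mainTheorem3 A f (a , fa≐𝓑) = B⇒¬self-image f γ a∈Bγ a∈fa
  where
  a∈𝓑 : 𝓑 f a
  a∈𝓑 = 𝓑-closed f λ y → proj₁ (fa≐𝓑 y)

  γ : Ord
  γ = proj₁ a∈𝓑

  a∈Bγ : B f γ a
  a∈Bγ = proj₂ a∈𝓑

  a∈fa : f a a
  a∈fa = proj₂ (fa≐𝓑 a) a∈𝓑
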